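{- Let $z\in\mathbb N$. Then there exists a clopen up-set of $Q$ containing $a_z$ but not $c_z$, and there exists a clopen up-set of $Q$ containing $c_z$ but not $a_z$.
   Context: Let $X$ be the Stone space of the Boolean algebra of all subsets of $\mathbb N$ (the Stone–Čech compactification of discrete $\mathbb N$), a compact totally disconnected space containing $\mathbb N$ with each $\{z\}$, $z\in\mathbb N$, open. For $z\in\mathbb N$ let $Q_z=\{g_z,a_z,b_z,c_z\}$ (four distinct elements) with $g_z<a_z,b_z,c_z$ and $a_z,b_z,c_z$ pairwise incomparable. For $x\in X\setminus\mathbb N$ let $Q_x=\{g_x,a_x,b_x\}$ with $g_x<a_x,b_x$, $a_x,b_x$ incomparable, and set $c_x:=a_x$. Let $Q$ be the disjoint union of the posets $Q_x$ ($x\in X$) (elements of distinct $Q_x$ incomparable), with the topology whose subbasis for the closed sets consists of the sets $\{a_u:u\in U\}$, $\{b_u:u\in U\}$, $\{c_u:u\in U\}$, $\{g_u:u\in U\}$ for $U$ clopen in $X$. -}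

module Defs where

open import Level using (Level; 0ℓ) renaming (suc to lsuc)
open import Data.Nat using (ℕ; _≟_)
open import Data.Bool using (Bool; true; false; _∧_; not; if_then_else_)
open import Data.Product using (Σ; Σ-syntax; _×_; _,_)
open import Data.Sum using (_⊎_)
open import Data.List using (List)
open import Data.List.Relation.Unary.Any using (Any)
open import Relation.Nullary using (¬_; does)
open import Relation.Binary.PropositionalEquality using (_≡_; refl)

-- The Boolean algebra of subsets of ℕ (as decidable/Boolean-valued
-- subsets ℕ → Bool) and its Stone space X = ultrafilters.

Subset : Set
Subset = ℕ → Bool

record X : Set where
  field
    F        : Subset → Bool                       -- F A ≡ true  means  A ∈ x
    F-top    : F (λ _ → true) ≡ true
    F-bot    : F (λ _ → false) ≡ false
    F-mono   : ∀ A B → F A ≡ true → (∀ n → A n ≡ true → B n ≡ true) → F B ≡ true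
    F-meet   : ∀ A B → F A ≡ true → F B ≡ true → F (λ n → A n ∧ B n) ≡ true
    F-ultra  : ∀ A → (F A ≡ true) ⊎ (F (λ n → not (A n)) ≡ true)
open X public

single : ℕ → Subset
single z n = does (n ≟ z)

principal : ℕ → X
principal z = record
  { F = λ A → A z
  ; F-top = refl
  ; F-bot = refl
  ; F-mono = λ A B Az h → h z Az
  ; F-meet = λ A B Az Bz → helper (A z) (B z) Az Bz
  ; F-ultra = λ A → ultra (A z)
  }
  where
  helper : ∀ a b → a ≡ true → b ≡ true → (a ∧ b) ≡ true
  helper true true _ _ = refl
  ultra : ∀ a → (a ≡ true) ⊎ (not a ≡ true)
  ultra true = _⊎_.inj₁ refl
  ultra false = _⊎_.inj₂ refl

isPrincipal : X → Set
isPrincipal x = Σ[ z ∈ ℕ ] (∀ A → F x A ≡ A z)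

-- Stone topology on X: basic open (clopen) sets [A] = {x | A ∈ x}
basic : Subset → X → Set
basic A x = F x A ≡ true

OpenX : (X → Set) → Set
OpenX U = ∀ x → U x → Σ[ A ∈ Subset ] (basic A x × (∀ y → basic A y → U y))

ClopenX : (X → Set) → Set
ClopenX U = OpenX U × OpenX (λ x → ¬ U x)

data Letter : Set where
  g a b c : Letter

-- an element of Q: a point x of X together with a letter; the letter c
-- is only available for x ∈ ℕ (for x ∉ ℕ, c_x := a_x).
record Q : Set where
  constructor mkQ
  field
    pt   : X
    kind : Letter
    ok   : kind ≡ c → isPrincipal pt
open Q public

-- order: the disjoint union of the posets Q_x, with g_x below a_x,b_x,c_x
_≤Q_ : Q → Q → Set
p ≤Q q = (pt p ≡ pt q) × ((kind p ≡ g) ⊎ (kind p ≡ kind q))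

UpSet : (Q → Set) → Set
UpSet S = ∀ p q → p ≤Q q → S p → S q

aℕ cℕ : ℕ → Q
aℕ z = mkQ (principal z) a (λ ())
cℕ z = mkQ (principal z) c (λ _ → z , λ A → refl)

-- q is the element ℓ_{pt q}  (with c_x = a_x for x ∉ ℕ)
IsLetter : Letter → Q → Set
IsLetter g q = kind q ≡ g
IsLetter a q = kind q ≡ a
IsLetter b q = kind q ≡ b
IsLetter c q = (kind q ≡ c) ⊎ ((kind q ≡ a) × ¬ isPrincipal (pt q))

-- subbasic closed sets {ℓ_u | u ∈ U}, U clopen in X
record SubClosed : Set₁ where
  constructor sub
  field
    letter : Letter
    U      : X → Set
    U-clopen : ClopenX U

inSub : SubClosed → Q → Set
inSub (sub ℓ U _) q = U (pt q) × IsLetter ℓ q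

inUnion : List SubClosed → Q → Set₁
inUnion L q = Any (λ s → inSub s q) L

-- closed sets of Q: intersections of finite unions of subbasic closed sets
ClosedQ : (Q → Set) → Set₂
ClosedQ S = Σ[ I ∈ Set₁ ] Σ[ Fam ∈ (I → List SubClosed) ]
              (∀ q → (S q → ∀ i → inUnion (Fam i) q) × ((∀ i → inUnion (Fam i) q) → S q))

ClopenQ : (Q → Set) → Set₂
ClopenQ S = ClosedQ S × ClosedQ (λ q → ¬ S q)

{-# OPTIONS --safe #-}
-- Over the clopen set U = {z} of X, the sets {a_u : u ∈ U} and {c_u : u ∈ U}
-- are subbasic closed, and they are up-sets because a and c are maximal in
-- each Q_x. Their complements are again finite unions of subbasic closed
-- sets: all points labelled by one of the other three letters, together with
-- the a- (resp. c-) points outside U. This needs U ⊆ ℕ, for at a point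
-- x ∉ ℕ the letters a and c name the same element.
module Submission where

open import Defs
open import Data.Nat using (ℕ; _≟_)
open import Data.Nat.Properties using (≡ᵇ⇒≡)
open import Data.Bool using (true; false; not)
open import Data.Bool.Properties using (¬-not; ∧-inverseʳ; T-≡)
open import Function.Base using (id; _∘_)
open import Function.Bundles using (Equivalence)
open import Data.Product using (Σ-syntax; _×_; _,_; proj₂)
open import Data.Sum using (_⊎_; inj₁; inj₂; [_,_])
open import Data.Unit.Polymorphic using (⊤; tt)
open import Data.Empty using (⊥)
open import Data.List using (List; []; _∷_; map; filter)
open import Data.List.Relation.Unary.Any using (here; there)
open import Data.List.Relation.Unary.Any.Properties using (map⁺; map⁻)
open import Data.List.Membership.Propositional using (_∈_; find; lose)
open import Data.List.Membership.Propositional.Properties using (∈-filter⁺; ∈-filter⁻)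
open import Level using (0ℓ) renaming (suc to lsuc)
open import Relation.Nullary using (¬_; yes; no; contradiction)
open import Relation.Nullary.Decidable using (dec-true; ¬?)
open import Relation.Binary.Definitions using (DecidableEquality)
open import Relation.Binary.PropositionalEquality using (_≡_; _≢_; refl; sym; trans; cong; subst)

∁ : Subset → Subset
∁ A n = not (A n)

basic-empty : ∀ x → ¬ basic (λ _ → false) x
basic-empty x ∅∈x with () ← trans (sym ∅∈x) (F-bot x)

basic-disjoint : ∀ x A → basic A x → basic (∁ A) x → ⊥
basic-disjoint x A A∈x ∁A∈x = basic-empty x
  (F-mono x _ _ (F-meet x A (∁ A) A∈x ∁A∈x) (λ n → trans (sym (∧-inverseʳ (A n)))))

basic-open : ∀ A → OpenX (basic A)
basic-open A x A∈x = A , A∈x , λ _ A∈y → A∈y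

∁basic-open : ∀ A → OpenX (λ x → ¬ basic A x)
∁basic-open A x A∉x with F-ultra x A
... | inj₁ A∈x  = contradiction A∈x A∉x
... | inj₂ ∁A∈x = ∁ A , ∁A∈x , λ y ∁A∈y A∈y → basic-disjoint y A A∈y ∁A∈y

¬∁basic-open : ∀ A → OpenX (λ x → ¬ ¬ basic A x)
¬∁basic-open A x ¬A∉x with F-ultra x A
... | inj₁ A∈x  = A , A∈x , λ _ A∈y A∉y → A∉y A∈y
... | inj₂ ∁A∈x = contradiction (λ A∈x → basic-disjoint x A A∈x ∁A∈x) ¬A∉x

basic-clopen : ∀ A → ClopenX (basic A)
basic-clopen A = basic-open A , ∁basic-open A

∁basic-clopen : ∀ A → ClopenX (λ x → ¬ basic A x)
∁basic-clopen A = ∁basic-open A , ¬∁basic-open A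

single-sound : ∀ {z n} → single z n ≡ true → n ≡ z
-- single z n is does (n ≟ z), which computes to n ≡ᵇ z.
single-sound {z} {n} z∋n = ≡ᵇ⇒≡ n z (Equivalence.from T-≡ z∋n)

single-self : ∀ z → basic (single z) (principal z)
single-self z = dec-true (z ≟ z) refl

single-principal : ∀ z x → basic (single z) x → isPrincipal x
single-principal z x z∈x = z , lawOf
  where
  lawOf : ∀ A → F x A ≡ A z
  lawOf A with A z in Az
  ... | true  = F-mono x (single z) A z∈x
                  (λ n e → trans (cong A (single-sound e)) Az)
  ... | false = ¬-not λ A∈x → basic-disjoint x A A∈x
                  (F-mono x (single z) (∁ A) z∈x
                    (λ n e → trans (cong (∁ A) (single-sound e)) (cong not Az)))

_≟ˡ_ : DecidableEquality Letter
g ≟ˡ g = yes refl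
g ≟ˡ a = no λ ()
g ≟ˡ b = no λ ()
g ≟ˡ c = no λ ()
a ≟ˡ g = no λ ()
a ≟ˡ a = yes refl
a ≟ˡ b = no λ ()
a ≟ˡ c = no λ ()
b ≟ˡ g = no λ ()
b ≟ˡ a = no λ ()
b ≟ˡ b = yes refl
b ≟ˡ c = no λ ()
c ≟ˡ g = no λ ()
c ≟ˡ a = no λ ()
c ≟ˡ b = no λ ()
c ≟ˡ c = yes refl

allLetters : List Letter
allLetters = g ∷ a ∷ b ∷ c ∷ []

∈-allLetters : ∀ ℓ → ℓ ∈ allLetters
∈-allLetters g = here refl
∈-allLetters a = there (here refl)
∈-allLetters b = there (there (here refl))
∈-allLetters c = there (there (there (here refl)))

otherLetters : Letter → List Letter
otherLetters ℓ = filter (λ ℓ′ → ¬? (ℓ′ ≟ˡ ℓ)) allLetters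

∈-otherLetters⁺ : ∀ {ℓ ℓ′} → ℓ′ ≢ ℓ → ℓ′ ∈ otherLetters ℓ
∈-otherLetters⁺ {ℓ} {ℓ′} = ∈-filter⁺ (λ ℓ″ → ¬? (ℓ″ ≟ˡ ℓ)) (∈-allLetters ℓ′)

∈-otherLetters⁻ : ∀ {ℓ ℓ′} → ℓ′ ∈ otherLetters ℓ → ℓ′ ≢ ℓ
∈-otherLetters⁻ {ℓ} = proj₂ ∘ ∈-filter⁻ (λ ℓ″ → ¬? (ℓ″ ≟ˡ ℓ)) {xs = allLetters}

isLetter-kind : ∀ q → IsLetter (kind q) q
isLetter-kind (mkQ _ g _) = refl
isLetter-kind (mkQ _ a _) = refl
isLetter-kind (mkQ _ b _) = refl
isLetter-kind (mkQ _ c _) = inj₁ refl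

isLetter-ok-irrelevant : ∀ ℓ {x k ok ok′} → IsLetter ℓ (mkQ x k ok) → IsLetter ℓ (mkQ x k ok′)
isLetter-ok-irrelevant g isL = isL
isLetter-ok-irrelevant a isL = isL
isLetter-ok-irrelevant b isL = isL
isLetter-ok-irrelevant c isL = isL

isLetter⇒kind : ∀ {ℓ} q → IsLetter ℓ q → kind q ≡ ℓ ⊎ (kind q ≡ a × ¬ isPrincipal (pt q))
isLetter⇒kind {g} _ k≡g = inj₁ k≡g
isLetter⇒kind {a} _ k≡a = inj₁ k≡a
isLetter⇒kind {b} _ k≡b = inj₁ k≡b
isLetter⇒kind {c} _ isC = isC

isLetter-principal : ∀ {ℓ} q → isPrincipal (pt q) → IsLetter ℓ q → kind q ≡ ℓ
isLetter-principal q principal-q isL =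
  [ id , (λ (_ , nonprincipal) → contradiction principal-q nonprincipal) ]
  (isLetter⇒kind q isL)

closedQ-finiteUnion : ∀ (L : List SubClosed) {S : Q → Set} →
  (∀ q → S q → inUnion L q) → (∀ q → inUnion L q → S q) → ClosedQ S
closedQ-finiteUnion L to from =
  ⊤ {lsuc 0ℓ} , (λ _ → L) , λ q → (λ s _ → to q s) , λ u → from q (u tt)

letterSet : Letter → Subset → Q → Set
letterSet ℓ A q = basic A (pt q) × IsLetter ℓ q

letterSet-closed : ∀ ℓ A → ClosedQ (letterSet ℓ A)
letterSet-closed ℓ A = closedQ-finiteUnion (sub ℓ (basic A) (basic-clopen A) ∷ [])
  (λ _ → here) (λ { _ (here s) → s })

everywhere : Letter → SubClosed
everywhere ℓ = sub ℓ (basic (λ _ → true)) (basic-clopen _)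

∁letterSet-cover : Letter → Subset → List SubClosed
∁letterSet-cover ℓ A = sub ℓ (λ x → ¬ basic A x) (∁basic-clopen A) ∷ map everywhere (otherLetters ℓ)

∁letterSet-closed : ∀ ℓ A → (∀ x → basic A x → isPrincipal x) → ClosedQ (λ q → ¬ letterSet ℓ A q)
∁letterSet-closed ℓ A A⊆ℕ = closedQ-finiteUnion (∁letterSet-cover ℓ A) to from
  where
  to : ∀ q → ¬ letterSet ℓ A q → inUnion (∁letterSet-cover ℓ A) q
  to q q∉S with kind q ≟ˡ ℓ
  ... | yes k≡ℓ = here ((λ A∈q → q∉S (A∈q , isL)) , isL)
    where isL = subst (λ ℓ′ → IsLetter ℓ′ q) k≡ℓ (isLetter-kind q)
  ... | no  k≢ℓ = there (map⁺ (lose (∈-otherLetters⁺ k≢ℓ) (F-top (pt q) , isLetter-kind q)))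

  from : ∀ q → inUnion (∁letterSet-cover ℓ A) q → ¬ letterSet ℓ A q
  from q (here (A∉q , _)) (A∈q , _) = A∉q A∈q
  from q (there u) (A∈q , isL) with find (map⁻ u)
  ... | ℓ′ , ℓ′∈others , (_ , isL′) =
    ∈-otherLetters⁻ ℓ′∈others
      (trans (sym (isLetter-principal q principal-q isL′)) (isLetter-principal q principal-q isL))
    where principal-q = A⊆ℕ (pt q) A∈q

letterSet-clopen : ∀ ℓ A → (∀ x → basic A x → isPrincipal x) → ClopenQ (letterSet ℓ A)
letterSet-clopen ℓ A A⊆ℕ = letterSet-closed ℓ A , ∁letterSet-closed ℓ A A⊆ℕ

letterSet-upSet : ∀ {ℓ A} → ℓ ≢ g → UpSet (letterSet ℓ A)
letterSet-upSet ℓ≢g p@(mkQ _ .g _) _ (refl , inj₁ refl) (_ , isL) with isLetter⇒kind p isL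
... | inj₁ g≡ℓ = contradiction (sym g≡ℓ) ℓ≢g
letterSet-upSet {ℓ} _ (mkQ x k _) (mkQ .x .k _) (refl , inj₂ refl) (A∈x , isL) =
  A∈x , isLetter-ok-irrelevant ℓ isL

lemma5 : (z : ℕ) →
    (Σ[ S ∈ (Q → Set) ] (ClopenQ S × UpSet S × S (aℕ z) × ¬ S (cℕ z)))
    × (Σ[ S ∈ (Q → Set) ] (ClopenQ S × UpSet S × S (cℕ z) × ¬ S (aℕ z)))
lemma5 z =
    ( letterSet a (single z) , letterSet-clopen a (single z) (single-principal z)
    , letterSet-upSet {a} (λ ()) , (single-self z , refl) , λ { (_ , ()) } )
  , ( letterSet c (single z) , letterSet-clopen c (single z) (single-principal z)
    , letterSet-upSet {c} (λ ()) , (single-self z , inj₁ refl) , c∌a )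
  where
  c∌a : ¬ letterSet c (single z) (aℕ z)
  c∌a (z∈z , isC) with () ← isLetter-principal (aℕ z) (single-principal z (principal z) z∈z) isC
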